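{- Let $m\geq 2$ be an integer. Then the Boros-Moll sequence $\{d_i(m)\}_{0\le i\le m}$ is spiral, i.e. \[ d_m(m)\le d_0(m)\le d_{m-1}(m)\le d_1(m)\le \cdots \le d_{\lfloor m/2\rfloor}(m), \] where the coefficients alternate $d_m, d_0, d_{m-1}, d_1, d_{m-2}, d_2,\dots$ ending at $d_{\lfloor m/2\rfloor}(m)$.
   Context: For a nonnegative integer $m$ and $0\le i\le m$, the Boros-Moll coefficients are \[ d_i(m)=2^{ -2m}\sum_{k=i}^m 2^k\binom{2m-2k}{m-k}\binom{m+k}{k}\binom{k}{i}. \] A sequence $\{a_i\}_{0\le i\le m}$ of positive numbers is called spiral if $a_m\le a_0\le a_{m-1}\le a_1\le \cdots\le a_{\lfloor m/2\rfloor}$ (terms taken alternately from the end and the beginning). -}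

module Defs where

open import Data.Nat using (ℕ; zero; suc; _+_; _*_; _∸_; _^_; _≤_; _<_; NonZero)
open import Data.Nat.Properties using (m^n≢0)
open import Data.Nat.Combinatorics using (_C_)
open import Data.Nat.DivMod using (_/_; _%_)
open import Data.List using (map; upTo)
open import Data.Nat.ListAction using (sum)
open import Data.Integer using (+_)
open import Data.Rational using (ℚ) renaming (_/_ to _÷_; _≤_ to _≤ℚ_; _<_ to _<ℚ_; 0ℚ to 0ℚ)

sumFromTo : ℕ → ℕ → (ℕ → ℕ) → ℕ
sumFromTo i m f = sum (map (λ j → f (i + j)) (upTo (suc (m ∸ i))))

-- 2^{2m} d_i(m) = Σ_{k=i}^{m} 2^k C(2m-2k, m-k) C(m+k, k) C(k, i)
scaledBM : ℕ → ℕ → ℕ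
scaledBM m i = sumFromTo i m (λ k → 2 ^ k * ((2 * m ∸ 2 * k) C (m ∸ k)) * ((m + k) C k) * (k C i))

d : ℕ → ℕ → ℚ
d i m = (+ scaledBM m i) ÷ (2 ^ (2 * m)) where
  instance _ : NonZero (2 ^ (2 * m))
  _ = m^n≢0 2 (2 * m)

-- The interleaved sequence a_m, a_0, a_{m-1}, a_1, a_{m-2}, a_2, ...
-- term 2k is a_{m-k}, term 2k+1 is a_k; terms 0..m end at a_{⌊m/2⌋}.
interleave : ℕ → (ℕ → ℚ) → ℕ → ℚ
interleave m a j with j % 2
... | 0 = a (m ∸ j / 2)
... | _ = a (j / 2)

Spiral : ℕ → (ℕ → ℚ) → Set
Spiral m a = (∀ i → i ≤ m → 0ℚ <ℚ a i)
           × (∀ j → j < m → interleave m a j ≤ℚ interleave m a (suc j))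
  where open import Data.Product using (_×_)

-- Clearing denominators, 2^{2m} d_i(m) = Σ_{t ≤ m} w_t C(t, i) with
-- w_t = 2^t C(2m−2t, m−t) C(m+t, t), the terms t < i being zero.  The step d_{m−k} ≤ d_k
-- holds term by term, since C(t, m−k) ≤ C(t, k) for all t ≤ m by symmetry and unimodality
-- of the rows of Pascal's triangle.  For d_k ≤ d_n with k + n = m − 1, the hockey-stick
-- identity gives Σ_{t ≤ m} C(t, k) = C(m+1, k+1) = Σ_{t ≤ m} C(t, n), and w_t increases
-- with t, so summing (w_m − w_t)(C(t, k) − C(t, n)) ≥ 0 over t yields the claim.

module Submission where

open import Defs
open import Data.Nat using (ℕ; zero; suc; _+_; _*_; _∸_; _^_; _≤_; _<_; z≤n; s≤s; _≤?_; NonZero)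
open import Data.Nat.Properties
open import Data.Nat.Combinatorics using (_C_; k>n⇒nCk≡0; nCk≡nC[n∸k]; nCk+nC[k+1]≡[n+1]C[k+1])
open import Data.Nat.Tactic.RingSolver using (solve)
open import Data.Nat.ListAction using (sum)
open import Data.Nat.DivMod using (_%_; m*n/n≡m; m*n%n≡0; [m+kn]%n≡m%n; +-distrib-/-∣ʳ)
open import Data.Nat.Divisibility using (divides-refl)
import Data.Integer as ℤ
import Data.Integer.Properties as ℤₚ
open import Data.Rational using (ℚ; 0ℚ) renaming (_/_ to _÷_; _≤_ to _≤ℚ_; _<_ to _<ℚ_)
open import Data.Rational.Properties using (positive⁻¹; normalize-pos; toℚᵘ-cancel-≤; toℚᵘ-fromℚᵘ)
import Data.Rational.Unnormalised as ℚᵘ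
import Data.Rational.Unnormalised.Properties as ℚᵘₚ
open import Data.List using (map; applyUpTo; _∷_; [])
open import Data.Product using (_,_)
open import Data.Sum using (inj₁; inj₂)
open import Function using (_∘_)
open import Relation.Binary.PropositionalEquality
open import Relation.Nullary using (yes; no)

binom : ℕ → ℕ → ℕ
binom zero    zero    = 1
binom zero    (suc k) = 0
binom (suc n) zero    = 1
binom (suc n) (suc k) = binom n k + binom n (suc k)

binom≡C : ∀ n k → binom n k ≡ n C k
binom≡C zero    zero    = refl
binom≡C zero    (suc k) = sym (k>n⇒nCk≡0 {0} {suc k} (s≤s z≤n))
binom≡C (suc n) zero    = refl
binom≡C (suc n) (suc k) =
  trans (cong₂ _+_ (binom≡C n k) (binom≡C n (suc k))) (nCk+nC[k+1]≡[n+1]C[k+1] n k)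

binom[n,0]≡1 : ∀ n → binom n 0 ≡ 1
binom[n,0]≡1 zero    = refl
binom[n,0]≡1 (suc n) = refl

binom[n,1]≡n : ∀ n → binom n 1 ≡ n
binom[n,1]≡n zero    = refl
binom[n,1]≡n (suc n) = cong₂ _+_ (binom[n,0]≡1 n) (binom[n,1]≡n n)

n<k⇒binom≡0 : ∀ {n k} → n < k → binom n k ≡ 0
n<k⇒binom≡0 {zero}  {suc k} _          = refl
n<k⇒binom≡0 {suc n} {suc k} (s≤s n<k) = cong₂ _+_ (n<k⇒binom≡0 n<k) (n<k⇒binom≡0 (m<n⇒m<1+n n<k))

n≤k⇒binom≤1 : ∀ {n k} → n ≤ k → binom n k ≤ 1
n≤k⇒binom≤1 {zero}  {zero}  _ = ≤-refl
n≤k⇒binom≤1 {zero}  {suc k} _ = z≤n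
n≤k⇒binom≤1 {suc n} {suc k} (s≤s n≤k)
  rewrite n<k⇒binom≡0 (s≤s n≤k) | +-identityʳ (binom n k) = n≤k⇒binom≤1 n≤k

k≤n⇒binom>0 : ∀ {n k} → k ≤ n → 0 < binom n k
k≤n⇒binom>0 {n}     {zero}  _         rewrite binom[n,0]≡1 n = s≤s z≤n
k≤n⇒binom>0 {suc n} {suc k} (s≤s k≤n) = ≤-trans (k≤n⇒binom>0 k≤n) (m≤m+n _ _)

binom-sym : ∀ a b → binom (a + b) a ≡ binom (a + b) b
binom-sym a b = begin
  binom (a + b) a       ≡⟨ binom≡C (a + b) a ⟩
  (a + b) C a           ≡⟨ nCk≡nC[n∸k] (m≤m+n a b) ⟩
  (a + b) C (a + b ∸ a) ≡⟨ cong ((a + b) C_) (m+n∸m≡n a b) ⟩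
  (a + b) C b           ≡⟨ binom≡C (a + b) b ⟨
  binom (a + b) b       ∎
  where open ≡-Reasoning

-- The hypotheses say that i is at least as close to the centre t/2 of the row as n.
t≤i+n⇒binom[t,n]≤binom[t,i] : ∀ t i n → i ≤ n → t ≤ i + n → binom t n ≤ binom t i
t≤i+n⇒binom[t,n]≤binom[t,i] zero    zero    zero    _ _ = ≤-refl
t≤i+n⇒binom[t,n]≤binom[t,i] zero    zero    (suc n) _ _ = z≤n
t≤i+n⇒binom[t,n]≤binom[t,i] zero    (suc i) (suc n) _ _ = ≤-refl
t≤i+n⇒binom[t,n]≤binom[t,i] (suc t) zero    n       _ t<n = n≤k⇒binom≤1 t<n
t≤i+n⇒binom[t,n]≤binom[t,i] (suc t) (suc i) (suc n) (s≤s i≤n) t≤1+i+n with t ≤? i + n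
... | yes t≤i+n = +-mono-≤ (t≤i+n⇒binom[t,n]≤binom[t,i] t i n i≤n t≤i+n)
                          (t≤i+n⇒binom[t,n]≤binom[t,i] t (suc i) (suc n) (s≤s i≤n)
                            (≤-trans t≤i+n (+-mono-≤ (n≤1+n i) (n≤1+n n))))
... | no t≰i+n rewrite ≤-antisym (≤-trans (≤-pred t≤1+i+n) (≤-reflexive (+-suc i n))) (≰⇒> t≰i+n) =
  ≤-reflexive (trans (+-comm (binom (suc i + n) n) _) (cong₂ _+_ outer inner))
  where
  open ≡-Reasoning
  outer : binom (suc i + n) (suc n) ≡ binom (suc i + n) i
  outer = begin
    binom (suc i + n) (suc n) ≡⟨ cong (λ r → binom r (suc n)) (+-suc i n) ⟨
    binom (i + suc n) (suc n) ≡⟨ binom-sym i (suc n) ⟨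
    binom (i + suc n) i       ≡⟨ cong (λ r → binom r i) (+-suc i n) ⟩
    binom (suc i + n) i       ∎
  inner : binom (suc i + n) n ≡ binom (suc i + n) (suc i)
  inner = sym (binom-sym (suc i) n)

binom-lower-step : ∀ n k → suc k * binom n (suc k) + k * binom n k ≡ n * binom n k
binom-lower-step zero    zero    = refl
binom-lower-step zero    (suc k) = cong₂ _+_ (*-zeroʳ (suc (suc k))) (*-zeroʳ (suc k))
binom-lower-step (suc n) zero    rewrite binom[n,1]≡n (suc n) = solve (n ∷ [])
binom-lower-step (suc n) (suc k) = combine (binom-lower-step n (suc k)) (binom-lower-step n k)
  where
  combine : ∀ {u x y} → (2 + k) * y + (1 + k) * x ≡ n * x → (1 + k) * x + k * u ≡ n * u →
            (2 + k) * (x + y) + (1 + k) * (u + x) ≡ (1 + n) * (u + x)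
  combine {u} {x} {y} eqˣ eqᵘ = begin
    (2 + k) * (x + y) + (1 + k) * (u + x)                        ≡⟨ solve (k ∷ u ∷ x ∷ y ∷ []) ⟩
    ((2 + k) * y + (1 + k) * x) + ((1 + k) * x + k * u) + x + u ≡⟨ cong₂ (λ p q → p + q + x + u) eqˣ eqᵘ ⟩
    n * x + n * u + x + u                                        ≡⟨ solve (n ∷ u ∷ x ∷ []) ⟩
    (1 + n) * (u + x)                                            ∎
    where open ≡-Reasoning

binom-absorption : ∀ n t → suc t * binom (suc n) (suc t) ≡ suc n * binom n t
binom-absorption n t = trans (distribute (binom n t) (binom n (suc t))) (cong (binom n t +_) (binom-lower-step n t))
  where
  distribute : ∀ u x → suc t * (u + x) ≡ u + (suc t * x + t * u)
  distribute u x = solve (t ∷ u ∷ x ∷ [])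

central : ℕ → ℕ
central j = binom (j + j) j

central-succ : ∀ j → suc j * central (suc j) ≡ 2 * (1 + j + j) * central j
central-succ j =
  ratio (binom-absorption (j + suc j) j) (trans (cong (suc j *_) middle) (binom-absorption (j + j) j))
  where
  open ≡-Reasoning
  middle : binom (j + suc j) j ≡ binom (suc (j + j)) (suc j)
  middle = trans (binom-sym j (suc j)) (cong (λ r → binom r (suc j)) (+-suc j j))
  ratio : ∀ {c′ y c} → suc j * c′ ≡ suc (j + suc j) * y → suc j * y ≡ suc (j + j) * c →
          suc j * c′ ≡ 2 * (1 + j + j) * c
  ratio {c′} {y} {c} e₁ e₂ = *-cancelˡ-≡ _ _ (suc j) (begin
    suc j * (suc j * c′)                ≡⟨ cong (suc j *_) e₁ ⟩
    suc j * (suc (j + suc j) * y)       ≡⟨ solve (j ∷ y ∷ []) ⟩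
    suc (j + suc j) * (suc j * y)       ≡⟨ cong (suc (j + suc j) *_) e₂ ⟩
    suc (j + suc j) * (suc (j + j) * c) ≡⟨ solve (j ∷ c ∷ []) ⟩
    suc j * (2 * (1 + j + j) * c)       ∎)

-- The coefficient of C(t, i) in 2^{2m} d_i(m).
weight : ℕ → ℕ → ℕ
weight m t = 2 ^ t * binom (2 * m ∸ 2 * t) (m ∸ t) * binom (m + t) t

weight-central : ∀ a t → weight (a + t) t ≡ 2 ^ t * central a * binom (a + t + t) t
weight-central a t = cong₂ (λ n k → 2 ^ t * binom n k * binom (a + t + t) t) double (m+n∸n≡m a t)
  where
  open ≡-Reasoning
  double : 2 * (a + t) ∸ 2 * t ≡ a + a
  double = begin
    2 * (a + t) ∸ 2 * t ≡⟨ *-distribˡ-∸ 2 (a + t) t ⟨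
    2 * (a + t ∸ t)     ≡⟨ cong (2 *_) (m+n∸n≡m a t) ⟩
    2 * a               ≡⟨ cong (a +_) (+-identityʳ a) ⟩
    a + a               ∎

-- For j = m − t − 1, c = central j, c′ = central (1+j), y = C(m+t, t) and y′ = C(m+t+1, t+1)
-- this is weight m t ≤ weight m (1+t): the quotient is (1+j)(2+j+2t) / ((1+t)(1+2j)), and
-- the numerator exceeds the denominator by j² + j + t + 1.
ratio-step-≤ : ∀ p j t {c c′ y y′} → suc j * c′ ≡ 2 * (1 + j + j) * c →
               suc t * y′ ≡ suc (suc j + t + t) * y → p * c′ * y ≤ 2 * p * c * y′
ratio-step-≤ p j t {c} {c′} {y} {y′} eᶜ eʸ = *-cancelˡ-≤ (suc j * suc t) (begin
  suc j * suc t * (p * c′ * y)                                              ≡⟨ solve (j ∷ t ∷ p ∷ c′ ∷ y ∷ []) ⟩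
  p * y * suc t * (suc j * c′)                                              ≡⟨ cong (p * y * suc t *_) eᶜ ⟩
  p * y * suc t * (2 * (1 + j + j) * c)                                     ≤⟨ m≤m+n _ _ ⟩
  p * y * suc t * (2 * (1 + j + j) * c) + 2 * p * c * y * (j * j + j + t + 1) ≡⟨ solve (j ∷ t ∷ p ∷ c ∷ y ∷ []) ⟩
  2 * p * c * suc j * (suc (suc j + t + t) * y)                             ≡⟨ cong (2 * p * c * suc j *_) eʸ ⟨
  2 * p * c * suc j * (suc t * y′)                                          ≡⟨ solve (j ∷ t ∷ p ∷ c ∷ y′ ∷ []) ⟩
  suc j * suc t * (2 * p * c * y′)                                          ∎)
  where open ≤-Reasoning

weight-step : ∀ {m t} → t < m → weight m t ≤ weight m (suc t)
weight-step {m} {t} t<m = begin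
  weight m t                                                  ≡⟨ cong (λ n → weight n t) e₁ ⟨
  weight (suc j + t) t                                        ≡⟨ weight-central (suc j) t ⟩
  2 ^ t * central (suc j) * binom (suc j + t + t) t           ≤⟨ ratio-step-≤ (2 ^ t) j t (central-succ j)
                                                                   (binom-absorption (suc j + t + t) t) ⟩
  2 ^ suc t * central j * binom (suc (suc j + t + t)) (suc t) ≡⟨ cong (λ n → 2 ^ suc t * central j * binom n (suc t)) shift ⟩
  2 ^ suc t * central j * binom (j + suc t + suc t) (suc t)   ≡⟨ weight-central j (suc t) ⟨
  weight (j + suc t) (suc t)                                  ≡⟨ cong (λ n → weight n (suc t)) e₂ ⟩
  weight m (suc t)                                            ∎
  where
  open ≤-Reasoning
  j = m ∸ suc t
  e₂ : j + suc t ≡ m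
  e₂ = m∸n+n≡m t<m
  e₁ : suc j + t ≡ m
  e₁ = trans (sym (+-suc j t)) e₂
  shift : suc (suc j + t + t) ≡ j + suc t + suc t
  shift = sym (trans (cong (_+ suc t) (+-suc j t)) (cong suc (+-suc (j + t) t)))

≤-last-of-stepwise : ∀ (f : ℕ → ℕ) {m} → (∀ {t} → t < m → f t ≤ f (suc t)) → ∀ {t} → t ≤ m → f t ≤ f m
≤-last-of-stepwise f {zero}  step z≤n = ≤-refl
≤-last-of-stepwise f {suc m} step t≤1+m with m≤n⇒m<n∨m≡n t≤1+m
... | inj₁ t<1+m = ≤-trans (≤-last-of-stepwise f (λ t<m → step (m<n⇒m<1+n t<m)) (≤-pred t<1+m)) (step ≤-refl)
... | inj₂ refl  = ≤-refl

weight-≤-last : ∀ {m t} → t ≤ m → weight m t ≤ weight m m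
weight-≤-last {m} = ≤-last-of-stepwise (weight m) weight-step

Σ< : ℕ → (ℕ → ℕ) → ℕ
Σ< zero    f = 0
Σ< (suc n) f = f 0 + Σ< n (f ∘ suc)

Σ<-cong : ∀ n {f g} → (∀ {t} → t < n → f t ≡ g t) → Σ< n f ≡ Σ< n g
Σ<-cong zero    f≗g = refl
Σ<-cong (suc n) f≗g = cong₂ _+_ (f≗g (s≤s z≤n)) (Σ<-cong n (λ t<n → f≗g (s≤s t<n)))

Σ<-mono-≤ : ∀ n {f g} → (∀ {t} → t < n → f t ≤ g t) → Σ< n f ≤ Σ< n g
Σ<-mono-≤ zero    f≤g = ≤-refl
Σ<-mono-≤ (suc n) f≤g = +-mono-≤ (f≤g (s≤s z≤n)) (Σ<-mono-≤ n (λ t<n → f≤g (s≤s t<n)))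

Σ<-split : ∀ a b f → Σ< (a + b) f ≡ Σ< a f + Σ< b (λ t → f (a + t))
Σ<-split zero    b f = refl
Σ<-split (suc a) b f = trans (cong (f 0 +_) (Σ<-split a b (f ∘ suc))) (sym (+-assoc (f 0) _ _))

Σ<-last : ∀ n f → Σ< (suc n) f ≡ Σ< n f + f n
Σ<-last n f = begin
  Σ< (suc n) f             ≡⟨ cong (λ k → Σ< k f) (+-comm 1 n) ⟩
  Σ< (n + 1) f             ≡⟨ Σ<-split n 1 f ⟩
  Σ< n f + (f (n + 0) + 0) ≡⟨ cong (Σ< n f +_) (trans (+-identityʳ _) (cong f (+-identityʳ n))) ⟩
  Σ< n f + f n             ∎
  where open ≡-Reasoning

Σ<-linear : ∀ n c f g → Σ< n (λ t → f t + c * g t) ≡ Σ< n f + c * Σ< n g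
Σ<-linear zero    c f g = sym (*-zeroʳ c)
Σ<-linear (suc n) c f g =
  trans (cong (f 0 + c * g 0 +_) (Σ<-linear n c (f ∘ suc) (g ∘ suc))) (regroup (f 0) (g 0) _ _)
  where
  regroup : ∀ a b s r → a + c * b + (s + c * r) ≡ a + s + c * (b + r)
  regroup a b s r = solve (c ∷ a ∷ b ∷ s ∷ r ∷ [])

hockey-stick : ∀ n j → Σ< n (λ t → binom t j) ≡ binom n (suc j)
hockey-stick zero    j = refl
hockey-stick (suc n) j = begin
  Σ< (suc n) (λ t → binom t j)       ≡⟨ Σ<-last n (λ t → binom t j) ⟩
  Σ< n (λ t → binom t j) + binom n j ≡⟨ cong (_+ binom n j) (hockey-stick n j) ⟩
  binom n (suc j) + binom n j        ≡⟨ +-comm (binom n (suc j)) (binom n j) ⟩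
  binom (suc n) (suc j)              ∎
  where open ≡-Reasoning

-- 2^{2m} d_i(m), with the vanishing terms t < i of the defining sum included.
fullBM : ℕ → ℕ → ℕ
fullBM m i = Σ< (suc m) (λ t → weight m t * binom t i)

sum-map-applyUpTo : ∀ {A : Set} n (g : A → ℕ) (h : ℕ → A) → sum (map g (applyUpTo h n)) ≡ Σ< n (g ∘ h)
sum-map-applyUpTo zero    g h = refl
sum-map-applyUpTo (suc n) g h = cong (g (h 0) +_) (sum-map-applyUpTo n g (h ∘ suc))

scaledBM≡fullBM : ∀ {m i} → i ≤ m → scaledBM m i ≡ fullBM m i
scaledBM≡fullBM {m} {i} i≤m = begin
  scaledBM m i                                     ≡⟨ sum-map-applyUpTo (suc (m ∸ i)) (λ j → f (i + j)) (λ t → t) ⟩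
  Σ< (suc (m ∸ i)) (λ j → f (i + j))               ≡⟨ Σ<-cong (suc (m ∸ i)) (λ {t} _ → f≡F (i + t)) ⟩
  Σ< (suc (m ∸ i)) (λ j → F (i + j))               ≡⟨ cong (_+ Σ< (suc (m ∸ i)) (λ j → F (i + j))) low-terms ⟨
  Σ< i F + Σ< (suc (m ∸ i)) (λ j → F (i + j))      ≡⟨ Σ<-split i (suc (m ∸ i)) F ⟨
  Σ< (i + suc (m ∸ i)) F                           ≡⟨ cong (λ k → Σ< k F) (trans (+-suc i (m ∸ i)) (cong suc (m+[n∸m]≡n i≤m))) ⟩
  fullBM m i                                       ∎
  where
  open ≡-Reasoning
  f : ℕ → ℕ
  f k = 2 ^ k * ((2 * m ∸ 2 * k) C (m ∸ k)) * ((m + k) C k) * (k C i)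
  F : ℕ → ℕ
  F t = weight m t * binom t i
  f≡F : ∀ k → f k ≡ F k
  f≡F k = sym (cong₂ _*_ (cong₂ _*_ (cong (2 ^ k *_) (binom≡C (2 * m ∸ 2 * k) (m ∸ k))) (binom≡C (m + k) k))
                         (binom≡C k i))
  low-terms : Σ< i F ≡ 0
  low-terms = trans (Σ<-cong i (λ {t} t<i → trans (cong (weight m t *_) (n<k⇒binom≡0 t<i)) (*-zeroʳ (weight m t))))
                    (Σ<-zero i)
    where
    Σ<-zero : ∀ n → Σ< n (λ _ → 0) ≡ 0
    Σ<-zero zero    = refl
    Σ<-zero (suc n) = Σ<-zero n

fullBM>0 : ∀ {m i} → i ≤ m → 0 < fullBM m i
fullBM>0 {m} {i} i≤m = begin
  1                                                            ≤⟨ *-mono-≤ weight[m,m]>0 (k≤n⇒binom>0 i≤m) ⟩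
  weight m m * binom m i                                       ≤⟨ m≤n+m _ _ ⟩
  Σ< m (λ t → weight m t * binom t i) + weight m m * binom m i ≡⟨ Σ<-last m _ ⟨
  fullBM m i                                                   ∎
  where
  open ≤-Reasoning
  weight[m,m]>0 : 0 < weight m m
  weight[m,m]>0 = subst (0 <_) (sym (weight-central 0 m))
                        (*-mono-≤ (*-mono-≤ (m^n>0 2 m) ≤-refl) (k≤n⇒binom>0 (m≤n+m m m)))

m≤i+n⇒fullBM[n]≤fullBM[i] : ∀ {m i n} → i ≤ n → m ≤ i + n → fullBM m n ≤ fullBM m i
m≤i+n⇒fullBM[n]≤fullBM[i] {m} {i} {n} i≤n m≤i+n = Σ<-mono-≤ (suc m) (λ {t} t≤m →
  *-monoʳ-≤ (weight m t) (t≤i+n⇒binom[t,n]≤binom[t,i] t i n i≤n (≤-trans (≤-pred t≤m) m≤i+n)))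

rearrangement : ∀ {x X y Y} → x ≤ X → y ≤ Y → x * Y + X * y ≤ x * y + X * Y
rearrangement {x} {y = y} x≤X y≤Y with m≤n⇒∃[o]m+o≡n x≤X | m≤n⇒∃[o]m+o≡n y≤Y
... | p , refl | q , refl = begin
  x * (y + q) + (x + p) * y              ≤⟨ m≤m+n _ (p * q) ⟩
  x * (y + q) + (x + p) * y + p * q      ≡⟨ solve (x ∷ y ∷ p ∷ q ∷ []) ⟩
  x * y + (x + p) * (y + q)              ∎
  where open ≤-Reasoning

1+i+n≡m⇒fullBM[i]≤fullBM[n] : ∀ {m i n} → i ≤ n → suc (i + n) ≡ m → fullBM m i ≤ fullBM m n
1+i+n≡m⇒fullBM[i]≤fullBM[n] {m} {i} {n} i≤n 1+i+n≡m = +-cancelʳ-≤ (W * S i) _ _ (begin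
  fullBM m i + W * S i                                     ≡⟨ cong (λ s → fullBM m i + W * s) row-sums ⟩
  fullBM m i + W * S n                                     ≡⟨ Σ<-linear (suc m) W (λ t → weight m t * binom t i) (λ t → binom t n) ⟨
  Σ< (suc m) (λ t → weight m t * binom t i + W * binom t n) ≤⟨ Σ<-mono-≤ (suc m) swap-≤ ⟩
  Σ< (suc m) (λ t → weight m t * binom t n + W * binom t i) ≡⟨ Σ<-linear (suc m) W (λ t → weight m t * binom t n) (λ t → binom t i) ⟩
  fullBM m n + W * S i                                     ∎)
  where
  open ≤-Reasoning
  W = weight m m
  S : ℕ → ℕ
  S j = Σ< (suc m) (λ t → binom t j)
  1+i+1+n≡1+m : suc i + suc n ≡ suc m
  1+i+1+n≡1+m = cong suc (trans (+-suc i n) 1+i+n≡m)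
  row-sums : S i ≡ S n
  row-sums = begin-equality
    S i                           ≡⟨ hockey-stick (suc m) i ⟩
    binom (suc m) (suc i)         ≡⟨ cong (λ r → binom r (suc i)) 1+i+1+n≡1+m ⟨
    binom (suc i + suc n) (suc i) ≡⟨ binom-sym (suc i) (suc n) ⟩
    binom (suc i + suc n) (suc n) ≡⟨ cong (λ r → binom r (suc n)) 1+i+1+n≡1+m ⟩
    binom (suc m) (suc n)         ≡⟨ hockey-stick (suc m) n ⟨
    S n                           ∎
  swap-≤ : ∀ {t} → t < suc m → weight m t * binom t i + W * binom t n ≤ weight m t * binom t n + W * binom t i
  swap-≤ {t} t<1+m with m≤n⇒m<n∨m≡n (≤-pred t<1+m)
  ... | inj₁ t<m  = rearrangement (weight-≤-last (<⇒≤ t<m))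
                      (t≤i+n⇒binom[t,n]≤binom[t,i] t i n i≤n (≤-pred (subst (t <_) (sym 1+i+n≡m) t<m)))
  ... | inj₂ refl = ≤-reflexive (+-comm (W * binom m i) (W * binom m n))

÷-pos : ∀ {a} q .{{_ : NonZero q}} → 0 < a → 0ℚ <ℚ (ℤ.+ a) ÷ q
÷-pos {suc a} q _ = positive⁻¹ _ {{normalize-pos (suc a) q}}

-- + a ÷ suc q is fromℚᵘ (mkℚᵘ (+ a) q), so it suffices to compare unnormalised fractions.
÷-mono-≤ : ∀ {a b} q .{{_ : NonZero q}} → a ≤ b → (ℤ.+ a) ÷ q ≤ℚ (ℤ.+ b) ÷ q
÷-mono-≤ {a} {b} (suc q) a≤b = toℚᵘ-cancel-≤
  (ℚᵘₚ.≤-respʳ-≃ (ℚᵘₚ.≃-sym (toℚᵘ-fromℚᵘ (ℚᵘ.mkℚᵘ (ℤ.+ b) q)))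
    (ℚᵘₚ.≤-respˡ-≃ (ℚᵘₚ.≃-sym (toℚᵘ-fromℚᵘ (ℚᵘ.mkℚᵘ (ℤ.+ a) q)))
      (ℚᵘ.*≤* (ℤₚ.*-monoʳ-≤-nonNeg (ℤ.+ suc q) (ℤ.+≤+ a≤b)))))

d>0 : ∀ {m i} → i ≤ m → 0ℚ <ℚ d i m
d>0 {m} {i} i≤m = ÷-pos (2 ^ (2 * m)) {{m^n≢0 2 (2 * m)}} (subst (0 <_) (sym (scaledBM≡fullBM i≤m)) (fullBM>0 i≤m))

fullBM-≤⇒d-≤ : ∀ {m i n} → i ≤ m → n ≤ m → fullBM m i ≤ fullBM m n → d i m ≤ℚ d n m
fullBM-≤⇒d-≤ {m} i≤m n≤m le = ÷-mono-≤ (2 ^ (2 * m)) {{m^n≢0 2 (2 * m)}}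
  (subst₂ _≤_ (sym (scaledBM≡fullBM i≤m)) (sym (scaledBM≡fullBM n≤m)) le)

k*2≡k+k : ∀ k → k * 2 ≡ k + k
k*2≡k+k k = solve (k ∷ [])

d[m∸k]≤d[k] : ∀ {m k} → k * 2 < m → d (m ∸ k) m ≤ℚ d k m
d[m∸k]≤d[k] {m} {k} 2k<m = fullBM-≤⇒d-≤ (m∸n≤m m k) k≤m
  (m≤i+n⇒fullBM[n]≤fullBM[i] (m+n≤o⇒m≤o∸n k k+k≤m) (≤-reflexive (sym (m+[n∸m]≡n k≤m))))
  where
  k+k≤m : k + k ≤ m
  k+k≤m = subst (_≤ m) (k*2≡k+k k) (<⇒≤ 2k<m)
  k≤m : k ≤ m
  k≤m = m+n≤o⇒m≤o k k+k≤m

d[k]≤d[m∸1+k] : ∀ {m k} → suc (k * 2) < m → d k m ≤ℚ d (m ∸ suc k) m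
d[k]≤d[m∸1+k] {m} {k} 1+2k<m = fullBM-≤⇒d-≤ (m+n≤o⇒m≤o k k+1+k≤m) (m∸n≤m m (suc k))
  (1+i+n≡m⇒fullBM[i]≤fullBM[n] (m+n≤o⇒m≤o∸n k k+1+k≤m) (m+[n∸m]≡n (m+n≤o⇒n≤o k k+1+k≤m)))
  where
  k+1+k≤m : k + suc k ≤ m
  k+1+k≤m = subst (_≤ m) (trans (cong suc (k*2≡k+k k)) (sym (+-suc k k))) (<⇒≤ 1+2k<m)

data Parity : ℕ → Set where
  even : ∀ k → Parity (k * 2)
  odd  : ∀ k → Parity (suc (k * 2))

parity : ∀ n → Parity n
parity zero = even 0
parity (suc n) with parity n
... | even k = odd k
... | odd k  = even (suc k)

interleave-even : ∀ m a k → interleave m a (k * 2) ≡ a (m ∸ k)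
interleave-even m a k with (k * 2) % 2 | m*n%n≡0 k 2
... | .0 | refl = cong (λ h → a (m ∸ h)) (m*n/n≡m k 2)

interleave-odd : ∀ m a k → interleave m a (suc (k * 2)) ≡ a k
interleave-odd m a k with suc (k * 2) % 2 | [m+kn]%n≡m%n 1 k 2
... | .1 | refl = cong a (trans (+-distrib-/-∣ʳ 1 {d = 2} (divides-refl k)) (m*n/n≡m k 2))


interleave-≤-suc : ∀ m (a : ℕ → ℚ) →
                   (∀ k → k * 2 < m → a (m ∸ k) ≤ℚ a k) →
                   (∀ k → suc (k * 2) < m → a k ≤ℚ a (m ∸ suc k)) →
                   ∀ j → j < m → interleave m a j ≤ℚ interleave m a (suc j)
interleave-≤-suc m a outer≤inner inner≤outer j with parity j
... | even k = λ 2k<m →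
  subst₂ _≤ℚ_ (sym (interleave-even m a k)) (sym (interleave-odd m a k)) (outer≤inner k 2k<m)
... | odd k  = λ 1+2k<m →
  subst₂ _≤ℚ_ (sym (interleave-odd m a k)) (sym (interleave-even m a (suc k))) (inner≤outer k 1+2k<m)

-- The spiral inequalities hold for every m.
corollary1p2 : (m : ℕ) → 2 ≤ m → Spiral m (λ i → d i m)
corollary1p2 m _ =
    (λ i → d>0 {m} {i})
  , interleave-≤-suc m (λ i → d i m) (λ k → d[m∸k]≤d[k] {m} {k}) (λ k → d[k]≤d[m∸1+k] {m} {k})
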